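{- Let $G$ be a connected graph with $G\neq K_1$. Then $D'(G\circ K_2)\leqslant \max\{D'(G),2\}$.
   Context: $K_1$ and $K_2$ are the complete graphs on one and two vertices. The corona $G\circ H$ is obtained by taking one copy of $G$ and $|V(G)|$ copies of $H$ and joining the $i$-th vertex of $G$ to every vertex of the $i$-th copy of $H$. The distinguishing index $D'(G)$ is the least $d$ such that some edge colouring $E(G)\to\{1,\dots,d\}$ (not necessarily proper) is preserved by no non-identity automorphism of $G$ (acting on edges). -}

module Defs where

open import Level using (0ℓ)
open import Data.Nat using (ℕ; _⊔_)
open import Data.Fin using (Fin)
open import Data.Sum using (_⊎_; inj₁; inj₂)
open import Data.Product using (_×_; _,_; Σ)
open import Data.Empty using (⊥)
open import Relation.Nullary using (¬_)
open import Relation.Binary.PropositionalEquality using (_≡_)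

record Graph (V : Set) : Set₁ where
  field
    Adj   : V → V → Set
    sym   : ∀ {u v} → Adj u v → Adj v u
    irref : ∀ {v} → ¬ Adj v v
open Graph public

data Reach {V : Set} (G : Graph V) : V → V → Set where
  here : ∀ {v} → Reach G v v
  step : ∀ {u v w} → Adj G u v → Reach G v w → Reach G u w

Connected : {V : Set} → Graph V → Set
Connected G = ∀ u v → Reach G u v

K₂ : Graph (Fin 2)
K₂ = record { Adj = λ u v → ¬ u ≡ v
            ; sym = λ p q → p (Relation.Binary.PropositionalEquality.sym q)
            ; irref = λ p → p Relation.Binary.PropositionalEquality.refl }

-- Corona G ∘ H: vertices of G (inj₁) plus, for each vertex a of G, a copy of H (inj₂ (a , w)).
CAdj : {V W : Set} → Graph V → Graph W → V ⊎ (V × W) → V ⊎ (V × W) → Set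
CAdj G H (inj₁ a) (inj₁ b) = Adj G a b
CAdj G H (inj₁ a) (inj₂ (b , w)) = a ≡ b
CAdj G H (inj₂ (a , w)) (inj₁ b) = a ≡ b
CAdj G H (inj₂ (a , w)) (inj₂ (b , w')) = (a ≡ b) × Adj H w w'

private
  open import Relation.Binary.PropositionalEquality as Eq using ()
  csym : {V W : Set} (G : Graph V) (H : Graph W) → ∀ {x y} → CAdj G H x y → CAdj G H y x
  csym G H {inj₁ a} {inj₁ b} p = sym G p
  csym G H {inj₁ a} {inj₂ (b , w)} p = Eq.sym p
  csym G H {inj₂ (a , w)} {inj₁ b} p = Eq.sym p
  csym G H {inj₂ (a , w)} {inj₂ (b , w')} (p , q) = Eq.sym p , sym H q
  cirr : {V W : Set} (G : Graph V) (H : Graph W) → ∀ {x} → ¬ CAdj G H x x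
  cirr G H {inj₁ a} p = irref G p
  cirr G H {inj₂ (a , w)} (_ , q) = irref H q

_∘ᶜ_ : {V W : Set} → Graph V → Graph W → Graph (V ⊎ (V × W))
G ∘ᶜ H = record { Adj = CAdj G H ; sym = λ {x} {y} → csym G H {x} {y} ; irref = λ {x} → cirr G H {x} }

record Automorphism {V : Set} (G : Graph V) : Set where
  field
    f       : V → V
    f⁻¹     : V → V
    invˡ    : ∀ v → f (f⁻¹ v) ≡ v
    invʳ    : ∀ v → f⁻¹ (f v) ≡ v
    pres    : ∀ {u v} → Adj G u v → Adj G (f u) (f v)
    refl'   : ∀ {u v} → Adj G (f u) (f v) → Adj G u v
open Automorphism public

-- An edge colouring with colours Fin d (not necessarily proper):
-- a colour for each edge {u,v}, given symmetrically.
record EdgeColouring {V : Set} (G : Graph V) (d : ℕ) : Set where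
  field
    col    : ∀ {u v} → Adj G u v → Fin d
    colSym : ∀ {u v} (e : Adj G u v) → col (sym G e) ≡ col e
    colIrr : ∀ {u v} (e e' : Adj G u v) → col e ≡ col e'
open EdgeColouring public

Preserves : {V : Set} {G : Graph V} {d : ℕ} → Automorphism G → EdgeColouring G d → Set
Preserves {G = G} σ c = ∀ {u v} (e : Adj G u v) → col c (pres σ e) ≡ col c e

Distinguishing : {V : Set} {G : Graph V} {d : ℕ} → EdgeColouring G d → Set
Distinguishing {G = G} c = ∀ (σ : Automorphism G) → Preserves σ c → ∀ v → f σ v ≡ v

DistIndexLE : {V : Set} → Graph V → ℕ → Set
DistIndexLE G d = Σ (EdgeColouring G d) λ c → Distinguishing {G = G} c

module Submission where

-- Colour the edges of G as in a distinguishing colouring of G, and in each pendant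
-- triangle {a, (a,0), (a,1)} give the spoke a—(a,w) colour w.  Every vertex of G has
-- three distinct neighbours (its own G-neighbour and the two triangle vertices), while a
-- triangle vertex has only two, so an automorphism σ of the corona maps G onto itself.
-- Its restriction preserves the colouring of G, hence is the identity; then σ fixes each
-- triangle vertex because the two spokes at a have different colours.

open import Defs
open import Data.Nat using (ℕ; _≤_; _⊔_; s≤s; suc)
open import Data.Nat.Properties using (m≤m⊔n; m≤n⊔m)
open import Data.Fin using (Fin; zero; suc; inject≤)
open import Data.Fin.Properties using (inject≤-injective)
open import Data.Sum using (_⊎_; inj₁; inj₂)
open import Data.Product using (_×_; _,_; ∃; proj₁; proj₂)
open import Data.Bool using (Bool; true; false)
open import Data.Empty using (⊥; ⊥-elim)
open import Function using (Injective)
open import Relation.Nullary using (contradiction)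
open import Relation.Binary.PropositionalEquality
  using (_≡_; _≢_; refl; cong; cong₂; trans; subst; subst₂) renaming (sym to ≡-sym)

≢-≢⇒≡ : ∀ {w u v : Fin 2} → w ≢ u → w ≢ v → u ≡ v
≢-≢⇒≡ {zero}     {zero}     {_}        w≢u _   = contradiction refl w≢u
≢-≢⇒≡ {zero}     {suc zero} {zero}     _   w≢v = contradiction refl w≢v
≢-≢⇒≡ {zero}     {suc zero} {suc zero} _   _   = refl
≢-≢⇒≡ {suc zero} {suc zero} {_}        w≢u _   = contradiction refl w≢u
≢-≢⇒≡ {suc zero} {zero}     {suc zero} _   w≢v = contradiction refl w≢v
≢-≢⇒≡ {suc zero} {zero}     {zero}     _   _   = refl

Bool-pigeonhole : (a b c : Bool) → a ≡ b ⊎ a ≡ c ⊎ b ≡ c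
Bool-pigeonhole true  true  _     = inj₁ refl
Bool-pigeonhole false false _     = inj₁ refl
Bool-pigeonhole true  false true  = inj₂ (inj₁ refl)
Bool-pigeonhole true  false false = inj₂ (inj₂ refl)
Bool-pigeonhole false true  true  = inj₂ (inj₂ refl)
Bool-pigeonhole false true  false = inj₂ (inj₁ refl)

module _ {V : Set} {G : Graph V} where

  f-injective : (σ : Automorphism G) → Injective _≡_ _≡_ (f σ)
  f-injective σ {x} {y} fx≡fy =
    trans (≡-sym (invʳ σ x)) (trans (cong (f⁻¹ σ) fx≡fy) (invʳ σ y))

  inverse : Automorphism G → Automorphism G
  inverse σ = record
    { f     = f⁻¹ σ
    ; f⁻¹   = f σ
    ; invˡ  = invʳ σ
    ; invʳ  = invˡ σ
    ; pres  = λ {u} {v} e →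
        refl' σ (subst₂ (Adj G) (≡-sym (invˡ σ u)) (≡-sym (invˡ σ v)) e)
    ; refl' = λ {u} {v} e → subst₂ (Adj G) (invˡ σ u) (invˡ σ v) (pres σ e)
    }

  recolour : ∀ {d D} → (Fin d → Fin D) → EdgeColouring G d → EdgeColouring G D
  recolour φ c = record
    { col    = λ e → φ (col c e)
    ; colSym = λ e → cong φ (colSym c e)
    ; colIrr = λ e e′ → cong φ (colIrr c e e′)
    }

  recolour-distinguishing : ∀ {d D} {φ : Fin d → Fin D} → Injective _≡_ _≡_ φ →
    (c : EdgeColouring G d) → Distinguishing c → Distinguishing (recolour φ c)
  recolour-distinguishing φ-inj c dist σ preserves = dist σ (λ e → φ-inj (preserves e))

  DistIndexLE-mono : ∀ {d D} → d ≤ D → DistIndexLE G d → DistIndexLE G D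
  DistIndexLE-mono d≤D (c , dist) =
    recolour (λ i → inject≤ i d≤D) c ,
    recolour-distinguishing (inject≤-injective d≤D d≤D _ _) c dist

  Reach⇒neighbour : ∀ {u v} → Reach G u v → u ≢ v → ∃ (Adj G u)
  Reach⇒neighbour here        u≢u = contradiction refl u≢u
  Reach⇒neighbour (step e _) _   = _ , e

other : ∀ {m} → Fin (suc (suc m)) → Fin (suc (suc m))
other zero    = suc zero
other (suc _) = zero

other-≢ : ∀ {m} (a : Fin (suc (suc m))) → a ≢ other a
other-≢ zero    ()
other-≢ (suc _) ()

connected⇒neighbour : ∀ {n} (G : Graph (Fin n)) → 2 ≤ n → Connected G → ∀ a → ∃ (Adj G a)
connected⇒neighbour G (s≤s (s≤s _)) conn a = Reach⇒neighbour (conn a (other a)) (other-≢ a)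

module CoronaK₂ {V : Set} (G : Graph V) (hasNeighbour : ∀ a → ∃ (Adj G a)) where

  C : Graph (V ⊎ (V × Fin 2))
  C = G ∘ᶜ K₂

  isBase : V ⊎ (V × Fin 2) → Bool
  isBase (inj₁ _) = true
  isBase (inj₂ _) = false

  vertexOf : V ⊎ (V × Fin 2) → V
  vertexOf (inj₁ a)       = a
  vertexOf (inj₂ (a , _)) = a

  copy-neighbours-sameSide⇒≡ : ∀ {a w y z} → Adj C (inj₂ (a , w)) y → Adj C (inj₂ (a , w)) z →
    isBase y ≡ isBase z → y ≡ z
  copy-neighbours-sameSide⇒≡ {y = inj₁ _} {inj₁ _} refl refl _ = refl
  copy-neighbours-sameSide⇒≡ {a} {y = inj₂ _} {inj₂ _} (refl , w≢u) (refl , w≢v) _ =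
    cong (λ t → inj₂ (a , t)) (≢-≢⇒≡ w≢u w≢v)

  copy-atMostTwoNeighbours : ∀ {a w y₁ y₂ y₃} →
    Adj C (inj₂ (a , w)) y₁ → Adj C (inj₂ (a , w)) y₂ → Adj C (inj₂ (a , w)) y₃ →
    y₁ ≡ y₂ ⊎ y₁ ≡ y₃ ⊎ y₂ ≡ y₃
  copy-atMostTwoNeighbours {y₁ = y₁} {y₂} {y₃} e₁ e₂ e₃
    with Bool-pigeonhole (isBase y₁) (isBase y₂) (isBase y₃)
  ... | inj₁ p         = inj₁ (copy-neighbours-sameSide⇒≡ e₁ e₂ p)
  ... | inj₂ (inj₁ p)  = inj₂ (inj₁ (copy-neighbours-sameSide⇒≡ e₁ e₃ p))
  ... | inj₂ (inj₂ p)  = inj₂ (inj₂ (copy-neighbours-sameSide⇒≡ e₂ e₃ p))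

  base↦base : (h : V ⊎ (V × Fin 2) → V ⊎ (V × Fin 2)) → Injective _≡_ _≡_ h →
    (∀ {x y} → Adj C x y → Adj C (h x) (h y)) →
    ∀ a → h (inj₁ a) ≡ inj₁ (vertexOf (h (inj₁ a)))
  base↦base h h-inj h-pres a with h (inj₁ a) in ha
  ... | inj₁ _ = refl
  ... | inj₂ (x , w) = ⊥-elim (distinct
          (copy-atMostTwoNeighbours (image {inj₂ (a , zero)} refl) (image {inj₂ (a , suc zero)} refl)
                                    (image {inj₁ (proj₁ (hasNeighbour a))} (proj₂ (hasNeighbour a)))))
    where
      image : ∀ {y} → Adj C (inj₁ a) y → Adj C (inj₂ (x , w)) (h y)
      image {y} e = subst (λ t → Adj C t (h y)) ha (h-pres {inj₁ a} {y} e)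

      distinct : ∀ {b} → h (inj₂ (a , zero)) ≡ h (inj₂ (a , suc zero))
                       ⊎ h (inj₂ (a , zero)) ≡ h (inj₁ b)
                       ⊎ h (inj₂ (a , suc zero)) ≡ h (inj₁ b) → ⊥
      distinct (inj₁ p)        = contradiction (h-inj p) λ ()
      distinct (inj₂ (inj₁ p)) = contradiction (h-inj p) λ ()
      distinct (inj₂ (inj₂ p)) = contradiction (h-inj p) λ ()

  onBase : Automorphism C → V → V
  onBase σ a = vertexOf (f σ (inj₁ a))

  f-inj₁ : (σ : Automorphism C) → ∀ a → f σ (inj₁ a) ≡ inj₁ (onBase σ a)
  f-inj₁ σ = base↦base (f σ) (f-injective σ) (λ {x} {y} → pres σ {x} {y})

  restrict : Automorphism C → Automorphism G
  restrict σ = record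
    { f     = onBase σ
    ; f⁻¹   = onBase (inverse σ)
    ; invˡ  = λ a → cong vertexOf
        (trans (cong (f σ) (≡-sym (f-inj₁ (inverse σ) a))) (invˡ σ (inj₁ a)))
    ; invʳ  = λ a → cong vertexOf
        (trans (cong (f⁻¹ σ) (≡-sym (f-inj₁ σ a))) (invʳ σ (inj₁ a)))
    ; pres  = λ {u} {v} e →
        subst₂ (Adj C) (f-inj₁ σ u) (f-inj₁ σ v) (pres σ {inj₁ u} {inj₁ v} e)
    ; refl' = λ {u} {v} e →
        refl' σ {inj₁ u} {inj₁ v} (subst₂ (Adj C) (≡-sym (f-inj₁ σ u)) (≡-sym (f-inj₁ σ v)) e)
    }

  module Colouring {d} (2≤d : 2 ≤ d) (c : EdgeColouring G d) where

    spoke : Fin 2 → Fin d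
    spoke w = inject≤ w 2≤d

    coronaCol : ∀ {x y} → Adj C x y → Fin d
    coronaCol {inj₁ _}       {inj₁ _}       e = col c e
    coronaCol {inj₁ _}       {inj₂ (_ , w)} _ = spoke w
    coronaCol {inj₂ (_ , w)} {inj₁ _}       _ = spoke w
    coronaCol {inj₂ _}       {inj₂ _}       _ = spoke zero

    coronaColouring : EdgeColouring C d
    coronaColouring = record
      { col    = λ {x} {y} → coronaCol {x} {y}
      ; colSym = λ {x} {y} → symmetric {x} {y}
      ; colIrr = λ {x} {y} → irrelevant {x} {y}
      }
      where
        symmetric : ∀ {x y} (e : Adj C x y) → coronaCol {y} {x} (Graph.sym C {x} {y} e) ≡ coronaCol {x} {y} e
        symmetric {inj₁ _} {inj₁ _} e = colSym c e
        symmetric {inj₁ _} {inj₂ _} _ = refl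
        symmetric {inj₂ _} {inj₁ _} _ = refl
        symmetric {inj₂ _} {inj₂ _} _ = refl

        irrelevant : ∀ {x y} (e e′ : Adj C x y) → coronaCol {x} {y} e ≡ coronaCol {x} {y} e′
        irrelevant {inj₁ _} {inj₁ _} e e′ = colIrr c e e′
        irrelevant {inj₁ _} {inj₂ _} _ _  = refl
        irrelevant {inj₂ _} {inj₁ _} _ _  = refl
        irrelevant {inj₂ _} {inj₂ _} _ _  = refl

    coronaCol-base : ∀ {x y a b} (x≡a : x ≡ inj₁ a) (y≡b : y ≡ inj₁ b) (e : Adj C x y) →
      coronaCol {x} {y} e ≡ col c (subst₂ (Adj C) x≡a y≡b e)
    coronaCol-base refl refl e = refl

    coronaCol-spoke : ∀ {x y a b w} → x ≡ inj₁ a → y ≡ inj₂ (b , w) → (e : Adj C x y) →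
      coronaCol {x} {y} e ≡ spoke w
    coronaCol-spoke refl refl e = refl

    restrict-preserves : (σ : Automorphism C) → Preserves σ coronaColouring → Preserves (restrict σ) c
    restrict-preserves σ preserves {u} {v} e =
      trans (≡-sym (coronaCol-base (f-inj₁ σ u) (f-inj₁ σ v) (pres σ {inj₁ u} {inj₁ v} e)))
            (preserves {inj₁ u} {inj₁ v} e)

    coronaColouring-distinguishing : Distinguishing c → Distinguishing coronaColouring
    coronaColouring-distinguishing dist σ preserves = fixes
      where
        fixes-base : ∀ a → f σ (inj₁ a) ≡ inj₁ a
        fixes-base a = trans (f-inj₁ σ a) (cong inj₁ (dist (restrict σ) (restrict-preserves σ preserves) a))

        fixes : ∀ x → f σ x ≡ x
        fixes (inj₁ a) = fixes-base a
        fixes (inj₂ (a , w)) with f σ (inj₂ (a , w)) in σaw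
        ... | inj₁ b = contradiction (f-injective σ (trans σaw (≡-sym (fixes-base b)))) λ ()
        ... | inj₂ (b , w′) = cong₂ (λ s t → inj₂ (s , t)) (≡-sym a≡b) w′≡w
          where
            spokeEdge : Adj C (f σ (inj₁ a)) (f σ (inj₂ (a , w)))
            spokeEdge = pres σ {inj₁ a} {inj₂ (a , w)} refl

            a≡b : a ≡ b
            a≡b = subst₂ (Adj C) (fixes-base a) σaw spokeEdge

            w′≡w : w′ ≡ w
            w′≡w = inject≤-injective _ _ _ _
              (trans (≡-sym (coronaCol-spoke (fixes-base a) σaw spokeEdge))
                     (preserves {inj₁ a} {inj₂ (a , w)} refl))

DistIndexLE-corona-K₂ : ∀ {V} (G : Graph V) → (∀ a → ∃ (Adj G a)) →
  ∀ {d} → 2 ≤ d → DistIndexLE G d → DistIndexLE (G ∘ᶜ K₂) d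
DistIndexLE-corona-K₂ G hasNeighbour 2≤d (c , dist) =
  coronaColouring , coronaColouring-distinguishing dist
  where open CoronaK₂.Colouring G hasNeighbour 2≤d c

mainTheorem15 : (n : ℕ) (G : Graph (Fin n)) → 2 ≤ n → Connected G →
    (d : ℕ) → DistIndexLE G d → DistIndexLE (G ∘ᶜ K₂) (d ⊔ 2)
mainTheorem15 n G 2≤n connected d D′G≤d =
  DistIndexLE-corona-K₂ G (connected⇒neighbour G 2≤n connected) (m≤n⊔m d 2)
    (DistIndexLE-mono (m≤m⊔n d 2) D′G≤d)
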